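{- Any deterministic $\mathsf{AMPC}$ algorithm with I/O capacity $S$ that computes $\textsc{1-vs-2-Cycle}$ on $n$ vertices requires at least $\frac13\log_S n-\frac13\log_S 32=\Omega(\log_S n)$ rounds. In particular, if $S=n^{\epsilon}$ for $\epsilon\in(0,1)$, then any such algorithm requires $\Omega(1/\epsilon)$ rounds.
   Context: Graphs on $n$ vertices ($n$ even) are encoded by adjacency matrix bits, i.e. as strings in $\{0,1\}^N$, $N=\binom n2$. $\textsc{1-vs-2-Cycle}:\Delta\to\{0,1\}$ is the partial Boolean function whose domain $\Delta$ consists of all $n$-vertex graphs that are a single cycle of length $n$ (value $1$) or two disjoint cycles each of length $n/2$ (value $0$). The deterministic $\mathsf{AMPC}$ model with I/O capacity $S$: computation proceeds in rounds using shared key–value stores $\mathcal{D}_0,\mathcal{D}_1,\dots$. $\mathcal{D}_0$ holds the input $x\in\{0,1\}^N$ as the $N$ pairs $(i,x_i)$. In round $r\ge1$, each machine (arbitrarily many, computationally unbounded) adaptively queries keys in $\mathcal{D}_{r-1}$, each response being the multiset of values under that key (empty if none), later queries depending on earlier responses. Per machine per round: total number of values received plus number of empty-response queries is at most $S$, and at most $S$ key–value pairs are written to $\mathcal{D}_r$. In every round, on every input in $\{0,1\}^N$ (including inputs outside $\Delta$), at most $S$ values are written under any single key; on inputs outside $\Delta$ the algorithm runs in the same way, a machine whose query budget would be exceeded stops querying and writes nothing. An algorithm computes $g$ in $R$ rounds if for every $x\in\Delta$, $\mathcal{D}_R$ contains exactly the single pair $(\textsc{answer},g(x))$. -}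

module Defs where

open import Data.Nat using (ℕ; zero; suc; _+_; _*_; _∸_; _≤_; _<_; _≤?_; _≟_)
open import Data.Nat.Properties using (≤-decTotalOrder)
open import Data.Bool using (Bool; true; false)
open import Data.Fin as Fin using (Fin; toℕ)
open import Data.List using (List; []; _∷_; length; map; filter; concatMap; allFin; lookup)
open import Data.Product using (_×_; _,_; proj₁; proj₂; ∃; ∃-syntax)
open import Data.Sum using (_⊎_)
open import Function.Definitions using (Injective)
open import Relation.Binary.PropositionalEquality using (_≡_)
open import Relation.Nullary using (yes; no)
open import Data.Nat.DivMod using (_mod_)
open import Data.List.Sort.MergeSort ≤-decTotalOrder using (mergeSort)
open import Data.List.Sort.Base using (SortingAlgorithm)

-- All unordered vertex pairs {u,v}, u < v, in a fixed order; these index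
-- the adjacency-matrix bits.  length (pairs n) = n choose 2.
pairs : (n : ℕ) → List (Fin n × Fin n)
pairs n = concatMap (λ v → map (λ u → (u , v)) (filter (λ u → u Fin.<? v) (allFin n))) (allFin n)

N : ℕ → ℕ
N n = length (pairs n)

Input : ℕ → Set
Input n = Fin (N n) → Bool

Bit : (n : ℕ) → Input n → Fin n → Fin n → Set
Bit n x u v = ∃[ i ] (lookup (pairs n) i ≡ (u , v) × x i ≡ true)

Adj : (n : ℕ) → Input n → Fin n → Fin n → Set
Adj n x u v = Bit n x u v ⊎ Bit n x v u

next : {m : ℕ} → Fin m → Fin m
next {suc m} k = (suc (toℕ k)) mod (suc m)

IsOneCycle : (n : ℕ) → Input n → Set
IsOneCycle n x = ∃[ σ ] (Injective _≡_ _≡_ σ ×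
  ((u v : Fin n) → (Adj n x u v → CycEdge σ u v) × (CycEdge σ u v → Adj n x u v)))
  where
  CycEdge : (Fin n → Fin n) → Fin n → Fin n → Set
  CycEdge σ u v = ∃[ k ] ((σ k ≡ u × σ (next k) ≡ v) ⊎ (σ k ≡ v × σ (next k) ≡ u))

IsTwoCycles : (m : ℕ) → Input (2 * m) → Set
IsTwoCycles m x = ∃[ σ ] (Injective _≡_ _≡_ σ ×
  ((u v : Fin (2 * m)) → (Adj (2 * m) x u v → CycEdge σ u v) × (CycEdge σ u v → Adj (2 * m) x u v)))
  where
  CycEdge : (Fin 2 × Fin m → Fin (2 * m)) → Fin (2 * m) → Fin (2 * m) → Set
  CycEdge σ u v = ∃[ h ] ∃[ k ] ((σ (h , k) ≡ u × σ (h , next k) ≡ v)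
                               ⊎ (σ (h , k) ≡ v × σ (h , next k) ≡ u))

Store : Set
Store = List (ℕ × ℕ)

-- response to a query: the multiset of values stored under key k,
-- represented canonically as a sorted list
sortℕ : List ℕ → List ℕ
sortℕ = SortingAlgorithm.sort mergeSort

valuesAt : ℕ → Store → List ℕ
valuesAt k D = map proj₂ (filter (λ p → proj₁ p ≟ k) D)

response : ℕ → Store → List ℕ
response k D = sortℕ (valuesAt k D)

-- Adaptive query strategy of one machine in one round (a decision tree over
-- query responses); a leaf lists the key–value pairs the machine writes.
data Strategy : Set where
  write : Store → Strategy
  query : ℕ → (List ℕ → Strategy) → Strategy

cost : List ℕ → ℕ
cost []      = 1
cost (v ∷ vs) = length (v ∷ vs)

-- run a strategy against store D with remaining query budget b; if the
-- budget would be exceeded the machine stops and writes nothing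
run : ℕ → Strategy → Store → Store
run b (write w)   D = w
run b (query k f) D with cost (response k D) ≤? b
... | yes _ = run (b ∸ cost (response k D)) (f (response k D)) D
... | no  _ = []

-- an algorithm: in round r+1 there are machines r machines, machine j
-- following strategy r j (reading D_r, writing into D_(r+1))
record Algorithm : Set where
  field
    machines : ℕ → ℕ
    strategy : (r : ℕ) → Fin (machines r) → Strategy

bit : Bool → ℕ
bit true  = 1
bit false = 0

store₀ : (n : ℕ) → Input n → Store
store₀ n x = map (λ i → (toℕ i , bit (x i))) (allFin (N n))

module _ (S : ℕ) (A : Algorithm) where
  open Algorithm A

  mutual
    store : (n : ℕ) → Input n → ℕ → Store
    store n x zero    = store₀ n x
    store n x (suc r) = concatMap (output n x r) (allFin (machines r))

    output : (n : ℕ) → Input n → (r : ℕ) → Fin (machines r) → Store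
    output n x r j = run S (strategy r j) (store n x r)

  Valid : ℕ → ℕ → Set
  Valid n R = (x : Input n) → (r : ℕ) → r < R →
      ((j : Fin (machines r)) → length (output n x r j) ≤ S)
    × ((k : ℕ) → length (valuesAt k (store n x (suc r))) ≤ S)

  Computes1vs2Cycle : (m : ℕ) → ℕ → ℕ → Set
  Computes1vs2Cycle m ans R = (x : Input (2 * m)) →
      (IsOneCycle (2 * m) x → store (2 * m) x R ≡ (ans , 1) ∷ [])
    × (IsTwoCycles m x → store (2 * m) x R ≡ (ans , 0) ∷ [])

-- A round-by-round degree argument.  Feed the algorithm a family of graphs x(y), y ∈ {0,1}^k, in
-- which every input bit depends on at most two coordinates of y.  After r rounds every additive
-- statistic of the store, as a function of y, has degree at most d_r over ℚ.  Indeed, a machine's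
-- adaptive query tree is a sum, over the finitely many possible responses, of the indicator of the
-- response times the rest of the tree.  A response, a sorted list of at most S values, is determined
-- by the counts of values under the queried key; these counts are statistics of degree d_r bounded
-- by S, so Lagrange interpolation recognises a response of c values with degree (c + 1) S d_r, and
-- as the query budget is S we get d_(r+1) = 2 S² d_r ≤ S³ d_r.
-- The gadget has two strands of k columns that cross between column j and the next one iff y_j
-- holds; it is one 2k-cycle if y has odd parity and two k-cycles otherwise.  So after R rounds the
-- answer is the parity of y, which has degree k since its top Fourier coefficient is nonzero; hence
-- k ≤ d_R ≤ 2 S^(3R).

module Submission where

open import Defs

module CubeDegree where

  open import Data.Nat as ℕ using (ℕ; zero; suc; _≤_; _<_; z≤n; s≤s)
  import Data.Nat.Properties as ℕₚ
  open import Data.Integer using (ℤ; +_; 0ℤ; 1ℤ; _+_; _*_; -_; _-_)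
  import Data.Integer.Properties as ℤₚ
  open import Data.Integer.Tactic.RingSolver using (solve-∀)
  open import Data.Bool using (Bool; true; false; not; _∧_; _xor_; if_then_else_)
  open import Data.Vec using (Vec; []; _∷_; lookup; _[_]%=_)
  open import Data.Vec.Properties using (lookup∘updateAt′)
  open import Data.Fin using (Fin; zero; suc)
  open import Data.Fin.Subset using (Subset; _∈_; _∉_; _∪_; ∣_∣; ⊥)
  open import Data.Fin.Subset.Properties
    using (∣⊥∣≡0; p⊆p∪q; q⊆p∪q; drop-there)
  open import Data.List using (List; []; _∷_; _++_; map; concatMap; foldr; length; upTo; applyUpTo)
  open import Data.List.Properties using (length-++; length-upTo; length-applyUpTo)
  open import Data.List.Membership.Propositional as List using ()
  open import Data.List.Membership.Propositional.Properties
    using (∈-++⁺ˡ; ∈-++⁺ʳ; ∈-++⁻; ∈-map⁺; ∈-upTo⁺; ∈-upTo⁻; ∈-applyUpTo⁺; ∈-applyUpTo⁻)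
  open import Data.List.Relation.Unary.Any using (here; there)
  open import Data.List.Relation.Unary.Unique.Propositional using (Unique)
  open import Data.List.Relation.Unary.AllPairs using (_∷_)
  open import Relation.Binary.Definitions using (DecidableEquality; tri<; tri≈; tri>)
  open import Data.List.Relation.Unary.All as All using (All; []; _∷_)
  open import Data.Product using (∃-syntax; _×_; _,_)
  open import Data.Sum using (inj₁; inj₂)
  open import Relation.Binary.PropositionalEquality
  open import Relation.Nullary using (¬_; yes; no; does; contradiction)
  open import Relation.Nullary.Decidable using (dec-true; dec-false)
  open import Relation.Unary using (Decidable)
  open import Function using (_∘_)

  𝟙 : Bool → ℤ
  𝟙 b = if b then 1ℤ else 0ℤ

  productℤ : List ℤ → ℤ
  productℤ = foldr _*_ 1ℤ

  𝟙-∧ : ∀ a b → 𝟙 (a ∧ b) ≡ 𝟙 a * 𝟙 b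
  𝟙-∧ true  b = sym (ℤₚ.*-identityˡ (𝟙 b))
  𝟙-∧ false b = sym (ℤₚ.*-zeroˡ (𝟙 b))

  𝟙-all : ∀ {A : Set} {P : A → Set} (P? : Decidable P) xs →
          productℤ (map (λ x → 𝟙 (does (P? x))) xs) ≡ 𝟙 (does (All.all? P? xs))
  𝟙-all P? []       = refl
  𝟙-all P? (x ∷ xs) = trans (cong (𝟙 (does (P? x)) *_) (𝟙-all P? xs)) (sym (𝟙-∧ (does (P? x)) _))

  sumℤ : List ℤ → ℤ
  sumℤ = foldr _+_ 0ℤ

  module _ {A : Set} (_≟_ : DecidableEquality A) (G : A → ℤ) (z : A) where

    private
      term : A → ℤ
      term a = 𝟙 (does (z ≟ a)) * G a

      term-≢ : ∀ {a} → z ≢ a → term a ≡ 0ℤ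
      term-≢ {a} z≢a = trans (cong (λ b → 𝟙 b * G a) (dec-false (z ≟ a) z≢a)) (ℤₚ.*-zeroˡ (G a))

      sum-≢ : ∀ {as} → All (z ≢_) as → sumℤ (map term as) ≡ 0ℤ
      sum-≢ []            = refl
      sum-≢ (z≢a ∷ z≢as) = cong₂ _+_ (term-≢ z≢a) (sum-≢ z≢as)

    sumℤ-select : ∀ {zs} → Unique zs → z List.∈ zs → sumℤ (map (λ a → 𝟙 (does (z ≟ a)) * G a) zs) ≡ G z
    sumℤ-select {_ ∷ as} (z≢zs ∷ _) (here refl) = begin
      term z + sumℤ (map term as) ≡⟨ cong₂ (λ b s → 𝟙 b * G z + s) (dec-true (z ≟ z) refl) (sum-≢ z≢zs) ⟩
      1ℤ * G z + 0ℤ               ≡⟨ trans (ℤₚ.+-identityʳ (1ℤ * G z)) (ℤₚ.*-identityˡ (G z)) ⟩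
      G z                         ∎
      where open ≡-Reasoning
    sumℤ-select {a ∷ as} (a≢as ∷ unique) (there z∈as) = begin
      term a + sumℤ (map term as) ≡⟨ cong (_+ sumℤ (map term as)) (term-≢ z≢a) ⟩
      0ℤ + sumℤ (map term as)     ≡⟨ ℤₚ.+-identityˡ (sumℤ (map term as)) ⟩
      sumℤ (map term as)          ≡⟨ sumℤ-select unique z∈as ⟩
      G z                         ∎
      where
      open ≡-Reasoning
      z≢a : z ≢ a
      z≢a z≡a = All.lookup a≢as z∈as (sym z≡a)

  ≢0-* : ∀ {a b : ℤ} → a ≢ 0ℤ → b ≢ 0ℤ → a * b ≢ 0ℤ
  ≢0-* {a} a≢0 b≢0 ab≡0 with ℤₚ.i*j≡0⇒i≡0∨j≡0 a ab≡0
  ... | inj₁ a≡0 = a≢0 a≡0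
  ... | inj₂ b≡0 = b≢0 b≡0

  Cube : ℕ → Set
  Cube k = Vec Bool k

  allCube : ∀ k → List (Cube k)
  allCube zero    = [] ∷ []
  allCube (suc k) = map (false ∷_) (allCube k) ++ map (true ∷_) (allCube k)

  ∈-allCube : ∀ {k} (y : Cube k) → y List.∈ allCube k
  ∈-allCube []          = here refl
  ∈-allCube (false ∷ y) = ∈-++⁺ˡ (∈-map⁺ (false ∷_) (∈-allCube y))
  ∈-allCube (true ∷ y)  = ∈-++⁺ʳ (map (false ∷_) (allCube _)) (∈-map⁺ (true ∷_) (∈-allCube y))

  DependsOnlyOn : ∀ {A : Set} {k} → Subset k → (Cube k → A) → Set
  DependsOnlyOn {k = k} p f =
    ∀ (y y′ : Cube k) → (∀ {i} → i ∈ p → lookup y i ≡ lookup y′ i) → f y ≡ f y′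

  ∣p∪q∣≤∣p∣+∣q∣ : ∀ {k} (p q : Subset k) → ∣ p ∪ q ∣ ≤ ∣ p ∣ ℕ.+ ∣ q ∣
  ∣p∪q∣≤∣p∣+∣q∣ []          []          = z≤n
  ∣p∪q∣≤∣p∣+∣q∣ (true ∷ p)  (true ∷ q)  =
    s≤s (ℕₚ.≤-trans (∣p∪q∣≤∣p∣+∣q∣ p q) (ℕₚ.+-monoʳ-≤ ∣ p ∣ (ℕₚ.n≤1+n ∣ q ∣)))
  ∣p∪q∣≤∣p∣+∣q∣ (true ∷ p)  (false ∷ q) = s≤s (∣p∪q∣≤∣p∣+∣q∣ p q)
  ∣p∪q∣≤∣p∣+∣q∣ (false ∷ p) (true ∷ q)  =
    subst (suc ∣ p ∪ q ∣ ≤_) (sym (ℕₚ.+-suc ∣ p ∣ ∣ q ∣)) (s≤s (∣p∪q∣≤∣p∣+∣q∣ p q))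
  ∣p∪q∣≤∣p∣+∣q∣ (false ∷ p) (false ∷ q) = ∣p∪q∣≤∣p∣+∣q∣ p q

  ∣p∣<k⇒∃∉ : ∀ {k} (p : Subset k) → ∣ p ∣ < k → ∃[ i ] i ∉ p
  ∣p∣<k⇒∃∉ (false ∷ p) _          = zero , λ ()
  ∣p∣<k⇒∃∉ (true ∷ p)  (s≤s ∣p∣<k) with i , i∉p ← ∣p∣<k⇒∃∉ p ∣p∣<k =
    suc i , i∉p ∘ drop-there

  record Junta (k d : ℕ) : Set where
    field
      support   : Subset k
      small     : ∣ support ∣ ≤ d
      eval      : Cube k → ℤ
      dependsOn : DependsOnlyOn support eval
  open Junta

  sumJuntas : ∀ {k d} → List (Junta k d) → Cube k → ℤ
  sumJuntas []      y = 0ℤ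
  sumJuntas (j ∷ J) y = eval j y + sumJuntas J y

  -- Degree over ℚ, with the denominator cleared.
  Deg≤ : ∀ {k} → ℕ → (Cube k → ℤ) → Set
  Deg≤ {k} d f = ∃[ c ] (c ≢ 0ℤ × ∃[ J ] (∀ y → c * f y ≡ sumJuntas {k} {d} J y))

  weaken : ∀ {k d d′} → d ≤ d′ → Junta k d → Junta k d′
  weaken d≤d′ j = record
    { support = support j ; small = ℕₚ.≤-trans (small j) d≤d′ ; eval = eval j ; dependsOn = dependsOn j }

  scale : ∀ {k d} → ℤ → Junta k d → Junta k d
  scale c j = record j
    { eval = λ y → c * eval j y ; dependsOn = λ y y′ eq → cong (c *_) (dependsOn j y y′ eq) }

  constant : ∀ {k} → ℤ → Junta k 0
  constant {k} c = record
    { support = ⊥ ; small = ℕₚ.≤-reflexive (∣⊥∣≡0 k) ; eval = λ _ → c ; dependsOn = λ _ _ _ → refl }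

  multiply : ∀ {k a b} → Junta k a → Junta k b → Junta k (a ℕ.+ b)
  multiply i j = record
    { support   = support i ∪ support j
    ; small     = ℕₚ.≤-trans (∣p∪q∣≤∣p∣+∣q∣ (support i) (support j))
                             (ℕₚ.+-mono-≤ (small i) (small j))
    ; eval      = λ y → eval i y * eval j y
    ; dependsOn = λ y y′ eq → cong₂ _*_
        (dependsOn i y y′ (eq ∘ p⊆p∪q (support j)))
        (dependsOn j y y′ (eq ∘ q⊆p∪q (support i) (support j)))
    }

  module _ {k : ℕ} where

    sumJuntas-weaken : ∀ {d d′} (d≤d′ : d ≤ d′) J y →
                       sumJuntas (map (weaken {k} d≤d′) J) y ≡ sumJuntas J y
    sumJuntas-weaken d≤d′ []      y = refl
    sumJuntas-weaken d≤d′ (j ∷ J) y = cong (_+_ (eval j y)) (sumJuntas-weaken d≤d′ J y)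

    sumJuntas-scale : ∀ {d} c (J : List (Junta k d)) y → sumJuntas (map (scale c) J) y ≡ c * sumJuntas J y
    sumJuntas-scale c []      y = sym (ℤₚ.*-zeroʳ c)
    sumJuntas-scale c (j ∷ J) y = trans (cong (_+_ (c * eval j y)) (sumJuntas-scale c J y))
                                        (sym (ℤₚ.*-distribˡ-+ c (eval j y) (sumJuntas J y)))

    sumJuntas-++ : ∀ {d} (J K : List (Junta k d)) y → sumJuntas (J ++ K) y ≡ sumJuntas J y + sumJuntas K y
    sumJuntas-++ []      K y = sym (ℤₚ.+-identityˡ _)
    sumJuntas-++ (j ∷ J) K y = trans (cong (_+_ (eval j y)) (sumJuntas-++ J K y))
                                     (sym (ℤₚ.+-assoc (eval j y) _ _))

    sumJuntas-multiply : ∀ {a b} (J : List (Junta k a)) (K : List (Junta k b)) y →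
      sumJuntas (concatMap (λ j → map (multiply j) K) J) y ≡ sumJuntas J y * sumJuntas K y
    sumJuntas-multiply []      K y = refl
    sumJuntas-multiply (j ∷ J) K y = begin
      sumJuntas (map (multiply j) K ++ concatMap (λ j → map (multiply j) K) J) y
        ≡⟨ sumJuntas-++ (map (multiply j) K) _ y ⟩
      sumJuntas (map (multiply j) K) y + sumJuntas (concatMap (λ j → map (multiply j) K) J) y
        ≡⟨ cong₂ _+_ (row K) (sumJuntas-multiply J K y) ⟩
      eval j y * sumJuntas K y + sumJuntas J y * sumJuntas K y
        ≡⟨ ℤₚ.*-distribʳ-+ (sumJuntas K y) (eval j y) (sumJuntas J y) ⟨
      (eval j y + sumJuntas J y) * sumJuntas K y ∎
      where
      open ≡-Reasoning
      row : ∀ K → sumJuntas (map (multiply j) K) y ≡ eval j y * sumJuntas K y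
      row []      = sym (ℤₚ.*-zeroʳ (eval j y))
      row (i ∷ K) = trans (cong (_+_ (eval j y * eval i y)) (row K))
                          (sym (ℤₚ.*-distribˡ-+ (eval j y) (eval i y) (sumJuntas K y)))

    Deg≤-weaken : ∀ {d d′} {f : Cube k → ℤ} → d ≤ d′ → Deg≤ d f → Deg≤ d′ f
    Deg≤-weaken d≤d′ (c , c≢0 , J , eq) =
      c , c≢0 , map (weaken d≤d′) J , λ y → trans (eq y) (sym (sumJuntas-weaken d≤d′ J y))

    Deg≤-cong : ∀ {d} {f g : Cube k → ℤ} → (∀ y → f y ≡ g y) → Deg≤ d f → Deg≤ d g
    Deg≤-cong f≗g (c , c≢0 , J , eq) = c , c≢0 , J , λ y → trans (cong (c *_) (sym (f≗g y))) (eq y)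

    Deg≤-cancel : ∀ {d} {f g : Cube k → ℤ} c → c ≢ 0ℤ → (∀ y → c * f y ≡ g y) → Deg≤ d g → Deg≤ d f
    Deg≤-cancel {f = f} c c≢0 cf≗g (a , a≢0 , J , eq) = a * c , ≢0-* a≢0 c≢0 , J ,
      λ y → trans (ℤₚ.*-assoc a c (f y)) (trans (cong (a *_) (cf≗g y)) (eq y))

    Deg≤-junta : ∀ {d} {p : Subset k} {f : Cube k → ℤ} → ∣ p ∣ ≤ d → DependsOnlyOn p f → Deg≤ d f
    Deg≤-junta {p = p} {f} ∣p∣≤d f-on-p = 1ℤ , (λ ()) ,
      record { support = p ; small = ∣p∣≤d ; eval = f ; dependsOn = f-on-p } ∷ [] ,
      λ y → trans (ℤₚ.*-identityˡ (f y)) (sym (ℤₚ.+-identityʳ (f y)))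

    Deg≤-const : ∀ c → Deg≤ 0 (λ (_ : Cube k) → c)
    Deg≤-const c = 1ℤ , (λ ()) , constant c ∷ [] , λ _ → trans (ℤₚ.*-identityˡ c) (sym (ℤₚ.+-identityʳ c))

    Deg≤-+ : ∀ {d} {f g : Cube k → ℤ} → Deg≤ d f → Deg≤ d g → Deg≤ d (λ y → f y + g y)
    Deg≤-+ {f = f} {g} (a , a≢0 , J , eqJ) (b , b≢0 , K , eqK) =
      a * b , ≢0-* a≢0 b≢0 , map (scale b) J ++ map (scale a) K , λ y → begin
        a * b * (f y + g y)                                 ≡⟨ distrib a b (f y) (g y) ⟩
        b * (a * f y) + a * (b * g y)                       ≡⟨ cong₂ _+_ (cong (b *_) (eqJ y)) (cong (a *_) (eqK y)) ⟩
        b * sumJuntas J y + a * sumJuntas K y               ≡⟨ cong₂ _+_ (sumJuntas-scale b J y) (sumJuntas-scale a K y) ⟨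
        sumJuntas (map (scale b) J) y + sumJuntas (map (scale a) K) y ≡⟨ sumJuntas-++ (map (scale b) J) _ y ⟨
        sumJuntas (map (scale b) J ++ map (scale a) K) y    ∎
      where
      open ≡-Reasoning
      distrib : ∀ a b u v → a * b * (u + v) ≡ b * (a * u) + a * (b * v)
      distrib = solve-∀

    Deg≤-* : ∀ {d e} {f g : Cube k → ℤ} → Deg≤ d f → Deg≤ e g → Deg≤ (d ℕ.+ e) (λ y → f y * g y)
    Deg≤-* {f = f} {g} (a , a≢0 , J , eqJ) (b , b≢0 , K , eqK) =
      a * b , ≢0-* a≢0 b≢0 , concatMap (λ j → map (multiply j) K) J , λ y → begin
        a * b * (f y * g y)             ≡⟨ interchange a b (f y) (g y) ⟩
        (a * f y) * (b * g y)           ≡⟨ cong₂ _*_ (eqJ y) (eqK y) ⟩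
        sumJuntas J y * sumJuntas K y   ≡⟨ sumJuntas-multiply J K y ⟨
        _                               ∎
      where
      open ≡-Reasoning
      interchange : ∀ a b u v → a * b * (u * v) ≡ (a * u) * (b * v)
      interchange = solve-∀

    Deg≤-sum : ∀ {d} {A : Set} (F : A → Cube k → ℤ) (as : List A) →
               All (λ a → Deg≤ d (F a)) as → Deg≤ d (λ y → sumℤ (map (λ a → F a y) as))
    Deg≤-sum F []       []         = Deg≤-weaken z≤n (Deg≤-const 0ℤ)
    Deg≤-sum F (a ∷ as) (Fa ∷ Fas) = Deg≤-+ Fa (Deg≤-sum F as Fas)

    Deg≤-product : ∀ {e} {A : Set} (F : A → Cube k → ℤ) (as : List A) →
                   All (λ a → Deg≤ e (F a)) as → Deg≤ (length as ℕ.* e) (λ y → productℤ (map (λ a → F a y) as))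
    Deg≤-product F []       []         = Deg≤-const 1ℤ
    Deg≤-product F (a ∷ as) (Fa ∷ Fas) = Deg≤-* Fa (Deg≤-product F as Fas)

  signedSum : ∀ k → (Cube k → ℤ) → ℤ
  signedSum zero    f = f []
  signedSum (suc k) f = signedSum k (λ y → f (false ∷ y)) - signedSum k (λ y → f (true ∷ y))

  signedSum-cong : ∀ k {f g : Cube k → ℤ} → (∀ y → f y ≡ g y) → signedSum k f ≡ signedSum k g
  signedSum-cong zero    f≗g = f≗g []
  signedSum-cong (suc k) f≗g =
    cong₂ _-_ (signedSum-cong k (λ y → f≗g (false ∷ y))) (signedSum-cong k (λ y → f≗g (true ∷ y)))

  signedSum-+ : ∀ k (f g : Cube k → ℤ) → signedSum k (λ y → f y + g y) ≡ signedSum k f + signedSum k g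
  signedSum-+ zero    f g = refl
  signedSum-+ (suc k) f g = trans
    (cong₂ _-_ (signedSum-+ k (λ y → f (false ∷ y)) (λ y → g (false ∷ y)))
               (signedSum-+ k (λ y → f (true ∷ y)) (λ y → g (true ∷ y))))
    (interchange (signedSum k (λ y → f (false ∷ y))) (signedSum k (λ y → g (false ∷ y)))
                 (signedSum k (λ y → f (true ∷ y))) (signedSum k (λ y → g (true ∷ y))))
    where
    interchange : ∀ a b c d → (a + b) - (c + d) ≡ (a - c) + (b - d)
    interchange = solve-∀

  signedSum-*ˡ : ∀ k c (f : Cube k → ℤ) → signedSum k (λ y → c * f y) ≡ c * signedSum k f
  signedSum-*ˡ zero    c f = refl
  signedSum-*ˡ (suc k) c f = trans
    (cong₂ _-_ (signedSum-*ˡ k c (λ y → f (false ∷ y))) (signedSum-*ˡ k c (λ y → f (true ∷ y))))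
    (distrib c _ _)
    where
    distrib : ∀ c a b → c * a - c * b ≡ c * (a - b)
    distrib = solve-∀

  signedSum-const : ∀ k c → signedSum (suc k) (λ _ → c) ≡ 0ℤ
  signedSum-const zero    c = ℤₚ.+-inverseʳ c
  signedSum-const (suc k) c = cong₂ _-_ (signedSum-const k c) (signedSum-const k c)

  signedSum-flipInvariant : ∀ k (i : Fin k) (f : Cube k → ℤ) →
                            (∀ y → f (y [ i ]%= not) ≡ f y) → signedSum k f ≡ 0ℤ
  signedSum-flipInvariant (suc k) zero f inv = trans
    (cong (_- signedSum k (λ y → f (true ∷ y))) (signedSum-cong k (λ y → inv (true ∷ y))))
    (ℤₚ.+-inverseʳ (signedSum k (λ y → f (true ∷ y))))
  signedSum-flipInvariant (suc k) (suc i) f inv = cong₂ _-_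
    (signedSum-flipInvariant k i _ (λ y → inv (false ∷ y)))
    (signedSum-flipInvariant k i _ (λ y → inv (true ∷ y)))

  signedSum-junta : ∀ {k d} → d < k → (j : Junta k d) → signedSum k (eval j) ≡ 0ℤ
  signedSum-junta {k} d<k j with i , i∉ ← ∣p∣<k⇒∃∉ (support j) (ℕₚ.≤-<-trans (small j) d<k) =
    signedSum-flipInvariant k i (eval j) λ y →
      dependsOn j _ y λ {i′} i′∈ → lookup∘updateAt′ i′ i (λ { refl → i∉ i′∈ }) y

  signedSum-Deg≤ : ∀ {k d} {f : Cube k → ℤ} → d < k → Deg≤ d f → signedSum k f ≡ 0ℤ
  signedSum-Deg≤ {k} {f = f} d<k (c , c≢0 , J , eq)
    with ℤₚ.i*j≡0⇒i≡0∨j≡0 c (trans (sym (signedSum-*ˡ k c f)) (trans (signedSum-cong k eq) (sums J)))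
    where
    zeros : ∀ k → signedSum k (λ _ → 0ℤ) ≡ 0ℤ
    zeros zero    = refl
    zeros (suc k) = cong₂ _-_ (zeros k) (zeros k)
    sums : ∀ J → signedSum k (sumJuntas J) ≡ 0ℤ
    sums []      = zeros k
    sums (j ∷ J) = trans (signedSum-+ k (eval j) (sumJuntas J)) (cong₂ _+_ (signedSum-junta d<k j) (sums J))
  ... | inj₁ c≡0  = contradiction c≡0 c≢0
  ... | inj₂ Lf≡0 = Lf≡0

  parity : ∀ {k} → Cube k → Bool
  parity []      = false
  parity (b ∷ y) = b xor parity y

  signedSum-parity≢0 : ∀ k → signedSum (suc k) (𝟙 ∘ parity) ≢ 0ℤ
  signedSum-parity≢0 zero    ()
  signedSum-parity≢0 (suc k) L≡0 = signedSum-parity≢0 k (half (trans (sym doubling) L≡0))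
    where
    L : ℤ
    L = signedSum (suc k) (𝟙 ∘ parity)
    flipped : ∀ y → 𝟙 (parity (true ∷ y)) ≡ 1ℤ + - 1ℤ * 𝟙 (parity y)
    flipped y with parity y
    ... | true  = refl
    ... | false = refl
    doubling : signedSum (suc (suc k)) (𝟙 ∘ parity) ≡ L + L
    doubling = begin
      L - signedSum (suc k) (λ y → 𝟙 (parity (true ∷ y)))       ≡⟨ cong (_-_ L) (signedSum-cong (suc k) flipped) ⟩
      L - signedSum (suc k) (λ y → 1ℤ + - 1ℤ * 𝟙 (parity y))
        ≡⟨ cong (_-_ L) (signedSum-+ (suc k) (λ _ → 1ℤ) (λ y → - 1ℤ * 𝟙 (parity y))) ⟩
      L - (signedSum (suc k) (λ _ → 1ℤ) + signedSum (suc k) (λ y → - 1ℤ * 𝟙 (parity y)))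
        ≡⟨ cong₂ (λ a b → L - (a + b)) (signedSum-const k 1ℤ) (signedSum-*ˡ (suc k) (- 1ℤ) (𝟙 ∘ parity)) ⟩
      L - (0ℤ + - 1ℤ * L)                                        ≡⟨ simplify L ⟩
      L + L                                                      ∎
      where
      open ≡-Reasoning
      simplify : ∀ a → a - (0ℤ + - 1ℤ * a) ≡ a + a
      simplify = solve-∀
    half : ∀ {a} → a + a ≡ 0ℤ → a ≡ 0ℤ
    half {a} a+a≡0 with ℤₚ.i*j≡0⇒i≡0∨j≡0 (+ 2) (trans (twice a) a+a≡0)
      where
      twice : ∀ a → + 2 * a ≡ a + a
      twice = solve-∀
    ... | inj₂ a≡0 = a≡0

  parity-Deg≤ : ∀ {k d} → Deg≤ d (λ (y : Cube k) → 𝟙 (parity y)) → k ≤ d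
  parity-Deg≤ {zero}  _ = z≤n
  parity-Deg≤ {suc k} {d} D with suc k ℕ.≤? d
  ... | yes k≤d = k≤d
  ... | no  k≰d = contradiction (signedSum-Deg≤ (ℕₚ.≰⇒> k≰d) D) (signedSum-parity≢0 k)

  rangeWithout : ℕ → ℕ → List ℕ
  rangeWithout c B = upTo c ++ applyUpTo (suc c ℕ.+_) (B ℕ.∸ c)

  length-rangeWithout : ∀ {c B} → c ≤ B → length (rangeWithout c B) ≡ B
  length-rangeWithout {c} {B} c≤B = begin
    length (upTo c ++ applyUpTo (suc c ℕ.+_) (B ℕ.∸ c))           ≡⟨ length-++ (upTo c) ⟩
    length (upTo c) ℕ.+ length (applyUpTo (suc c ℕ.+_) (B ℕ.∸ c))
      ≡⟨ cong₂ ℕ._+_ (length-upTo c) (length-applyUpTo (suc c ℕ.+_) (B ℕ.∸ c)) ⟩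
    c ℕ.+ (B ℕ.∸ c)                                               ≡⟨ ℕₚ.m+[n∸m]≡n c≤B ⟩
    B                                                             ∎
    where open ≡-Reasoning

  ∉-rangeWithout : ∀ c B → ¬ c List.∈ rangeWithout c B
  ∉-rangeWithout c B c∈ with ∈-++⁻ (upTo c) c∈
  ... | inj₁ c∈upTo = ℕₚ.<-irrefl refl (∈-upTo⁻ c∈upTo)
  ... | inj₂ c∈rest with i , _ , c≡1+c+i ← ∈-applyUpTo⁻ (suc c ℕ.+_) c∈rest =
    ℕₚ.<-irrefl c≡1+c+i (s≤s (ℕₚ.m≤m+n c i))

  ∈-rangeWithout : ∀ {c B x} → x ≤ B → x ≢ c → x List.∈ rangeWithout c B
  ∈-rangeWithout {c} {B} {x} x≤B x≢c with ℕₚ.<-cmp x c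
  ... | tri< x<c _ _ = ∈-++⁺ˡ (∈-upTo⁺ x<c)
  ... | tri≈ _ x≡c _ = contradiction x≡c x≢c
  ... | tri> _ _ c<x = ∈-++⁺ʳ (upTo c) (subst (List._∈ applyUpTo (suc c ℕ.+_) (B ℕ.∸ c))
      (ℕₚ.m+[n∸m]≡n c<x) (∈-applyUpTo⁺ (suc c ℕ.+_) (ℕₚ.∸-monoˡ-< (s≤s x≤B) c<x)))

  differences : ℕ → List ℕ → List ℤ
  differences x = map (λ j → + x - + j)

  productℤ-differences-∈ : ∀ {x js} → x List.∈ js → productℤ (differences x js) ≡ 0ℤ
  productℤ-differences-∈ {x} {_ ∷ js} (here refl) =
    trans (cong (_* productℤ (differences x js)) (ℤₚ.+-inverseʳ (+ x))) (ℤₚ.*-zeroˡ (productℤ (differences x js)))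
  productℤ-differences-∈ {x} {j ∷ _} (there x∈js) =
    trans (cong (_*_ (+ x - + j)) (productℤ-differences-∈ x∈js)) (ℤₚ.*-zeroʳ (+ x - + j))

  productℤ-differences-∉ : ∀ {x} js → ¬ x List.∈ js → productℤ (differences x js) ≢ 0ℤ
  productℤ-differences-∉ []       x∉js ()
  productℤ-differences-∉ {x} (j ∷ js) x∉js = ≢0-*
    (λ x-j≡0 → x∉js (here (ℤₚ.+-injective (ℤₚ.i-j≡0⇒i≡j (+ x) (+ j) x-j≡0))))
    (productℤ-differences-∉ js (x∉js ∘ there))

  -- Lagrange interpolation: on the values 0 … B the polynomial ∏_{j ≠ c} (x - j) is a nonzero multiple
  -- of the indicator of x = c.
  Deg≤-𝟙-≡ᵇ : ∀ {k e B} (g : Cube k → ℕ) → (∀ y → g y ≤ B) → Deg≤ e (λ y → + g y) →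
            ∀ c → Deg≤ (B ℕ.* e) (λ y → 𝟙 (g y ℕ.≡ᵇ c))
  Deg≤-𝟙-≡ᵇ {e = e} {B} g g≤B Dg c with c ℕ.≤? B
  ... | no c≰B = Deg≤-cong never (Deg≤-weaken z≤n (Deg≤-const 0ℤ))
    where
    never : ∀ y → 0ℤ ≡ 𝟙 (g y ℕ.≡ᵇ c)
    never y = sym (cong 𝟙 (dec-false (g y ℕ.≟ c) λ { refl → c≰B (g≤B y) }))
  ... | yes c≤B = Deg≤-cancel K K≢0 lagrange
    (subst (λ l → Deg≤ (l ℕ.* e) (λ y → productℤ (differences (g y) (rangeWithout c B))))
      (length-rangeWithout c≤B)
      (Deg≤-product (λ j y → + g y - + j) (rangeWithout c B)
        (All.tabulate λ {j} _ → Deg≤-+ Dg (Deg≤-weaken z≤n (Deg≤-const (- + j))))))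
    where
    K : ℤ
    K = productℤ (differences c (rangeWithout c B))
    K≢0 : K ≢ 0ℤ
    K≢0 = productℤ-differences-∉ (rangeWithout c B) (∉-rangeWithout c B)
    lagrange : ∀ y → K * 𝟙 (g y ℕ.≡ᵇ c) ≡ productℤ (differences (g y) (rangeWithout c B))
    lagrange y with g y ℕ.≟ c
    ... | yes refl = trans (cong (λ b → K * 𝟙 b) (dec-true (c ℕ.≟ c) refl)) (ℤₚ.*-identityʳ K)
    ... | no gy≢c  = begin
      K * 𝟙 (g y ℕ.≡ᵇ c) ≡⟨ cong (λ b → K * 𝟙 b) (dec-false (g y ℕ.≟ c) gy≢c) ⟩
      K * 0ℤ             ≡⟨ ℤₚ.*-zeroʳ K ⟩
      0ℤ                 ≡⟨ productℤ-differences-∈ (∈-rangeWithout (g≤B y) gy≢c) ⟨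
      productℤ (differences (g y) (rangeWithout c B)) ∎
      where open ≡-Reasoning

module Multisets where

  open import Data.Nat using (ℕ; suc; _≤_; _≟_; s≤s; z≤n)
  import Data.Nat.Properties as ℕₚ
  open import Data.List using (List; []; _∷_; _++_; length; filter)
  open import Data.List.Properties using (filter-accept; filter-reject; filter-none)
  open import Data.List.Relation.Unary.Unique.Propositional using (Unique)
  open import Data.List.Relation.Unary.AllPairs using ([]; _∷_)
  open import Data.List.Membership.Propositional using (_∈_)
  open import Data.List.Membership.Propositional.Properties using (∈-filter⁻; ∈-∃++)
  open import Data.List.Relation.Unary.All using (All; []; _∷_)
  import Data.List.Relation.Unary.All as All
  open import Data.List.Relation.Unary.Any using (here)
  open import Data.List.Relation.Binary.Permutation.Propositional
    using (_↭_; prep; ↭-refl; ↭-sym; ↭-trans; ↭⇒↭ₛ)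
  open import Data.List.Relation.Binary.Permutation.Propositional.Properties
    using (↭-length; filter-↭; shift)
  import Data.List.Relation.Binary.Pointwise as Pointwise
  open import Data.List.Relation.Unary.Sorted.TotalOrder (ℕₚ.≤-totalOrder) using (Sorted)
  open import Data.List.Relation.Unary.Sorted.TotalOrder.Properties using (↗↭↗⇒≋)
  open import Data.List.Sort.Base using (SortingAlgorithm)
  open import Data.List.Sort.MergeSort ℕₚ.≤-decTotalOrder using (mergeSort)
  open import Data.Product using (_×_; _,_)
  open import Function using (_∘_; _⇔_; mk⇔)
  open import Relation.Binary.PropositionalEquality
  open import Relation.Nullary using (yes; no)

  count : ℕ → List ℕ → ℕ
  count v = length ∘ filter (_≟ v)

  count-↭ : ∀ v {xs ys} → xs ↭ ys → count v xs ≡ count v ys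
  count-↭ v = ↭-length ∘ filter-↭ (_≟ v)

  count-∷-cancel : ∀ w v xs ys → count w (v ∷ xs) ≡ count w (v ∷ ys) → count w xs ≡ count w ys
  count-∷-cancel w v xs ys eq with v ≟ w
  ... | yes v≡w = ℕₚ.suc-injective (subst₂ _≡_ (accept xs) (accept ys) eq)
    where
    accept : ∀ zs → count w (v ∷ zs) ≡ suc (count w zs)
    accept zs = cong length (filter-accept (_≟ w) {xs = zs} v≡w)
  ... | no v≢w  = subst₂ _≡_ (reject xs) (reject ys) eq
    where
    reject : ∀ zs → count w (v ∷ zs) ≡ count w zs
    reject zs = cong length (filter-reject (_≟ w) {xs = zs} v≢w)

  count-head : ∀ v xs → count v (v ∷ xs) ≡ suc (count v xs)
  count-head v xs = cong length (filter-accept (_≟ v) {xs = xs} refl)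

  count-unique : ∀ v {xs} → Unique xs → count v xs ≤ 1
  count-unique v {[]}     []          = z≤n
  count-unique v {x ∷ xs} (x≢xs ∷ u) with x ≟ v
  ... | yes refl = ℕₚ.≤-reflexive (trans (count-head x xs)
                     (cong (suc ∘ length) (filter-none (_≟ x) (All.map (λ x≢y y≡x → x≢y (sym y≡x)) x≢xs))))
  ... | no x≢v   = subst (_≤ 1) (sym (cong length (filter-reject (_≟ v) {xs = xs} x≢v))) (count-unique v u)

  count>0⇒∈ : ∀ v xs → 1 ≤ count v xs → v ∈ xs
  count>0⇒∈ v xs 1≤count with filter (_≟ v) xs in eq
  ... | u ∷ _ with u∈xs , refl ← ∈-filter⁻ (_≟ v) {xs = xs} (subst (u ∈_) (sym eq) (here refl)) = u∈xs

  ↭-from-counts : ∀ xs ys → All (λ v → count v xs ≡ count v ys) ys → length xs ≡ length ys → xs ↭ ys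
  ↭-from-counts []      []       _        _   = ↭-refl
  ↭-from-counts (_ ∷ _) []       _        ()
  ↭-from-counts xs      (v ∷ ys) (c ∷ cs) len
    with as , bs , refl ← ∈-∃++ (count>0⇒∈ v xs (subst (1 ≤_) (sym (trans c (count-head v ys))) (s≤s z≤n)))
    = ↭-trans xs↭ (prep v (↭-from-counts (as ++ bs) ys (All.map cancel cs)
                                          (ℕₚ.suc-injective (trans (sym (↭-length xs↭)) len))))
    where
    xs↭ : as ++ v ∷ bs ↭ v ∷ as ++ bs
    xs↭ = shift v as bs
    cancel : ∀ {w} → count w (as ++ v ∷ bs) ≡ count w (v ∷ ys) → count w (as ++ bs) ≡ count w ys
    cancel {w} eq = count-∷-cancel w v (as ++ bs) ys (trans (sym (count-↭ w xs↭)) eq)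

  sortℕ≡⇔ : ∀ xs {ys} → Sorted ys →
            (sortℕ xs ≡ ys) ⇔ (All (λ v → count v xs ≡ count v ys) ys × length xs ≡ length ys)
  sortℕ≡⇔ xs {ys} ys↗ = mk⇔ to from
    where
    open SortingAlgorithm mergeSort using (sort-↭; sort-↗)
    to : sortℕ xs ≡ ys → All (λ v → count v xs ≡ count v ys) ys × length xs ≡ length ys
    to refl = All.tabulate (λ {v} _ → count-↭ v (↭-sym (sort-↭ xs))) , ↭-length (↭-sym (sort-↭ xs))
    from : All (λ v → count v xs ≡ count v ys) ys × length xs ≡ length ys → sortℕ xs ≡ ys
    from (counts , len) = Pointwise.Pointwise-≡⇒≡
      (↗↭↗⇒≋ ℕₚ.≤-totalOrder (sort-↗ xs) ys↗
        (↭⇒↭ₛ (↭-trans (sort-↭ xs) (↭-from-counts xs ys counts len))))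

module RoundDegree where

  open CubeDegree
  open Multisets
  open import Data.Nat as ℕ using (ℕ; zero; suc; _≤_; _<_; z≤n; s≤s; _≡ᵇ_; _∸_; _≤?_)
  import Data.Nat.Properties as ℕₚ
  open import Data.Integer using (ℤ; +_; 0ℤ; _+_; _*_)
  import Data.Integer.Properties as ℤₚ
  open import Data.Bool using (Bool; true; false)
  open import Data.Fin using (toℕ)
  import Data.Fin.Properties as Finₚ
  open import Data.Fin.Subset using (∣_∣)
  open import Data.List using (List; []; _∷_; _++_; map; length; concatMap; allFin; deduplicate)
  open import Data.List.Properties using (map-∘; length-filter; ≡-dec)
  open import Data.List.Membership.Propositional using (_∈_)
  open import Data.List.Membership.Propositional.Properties
    using (∈-map⁺; ∈-map⁻; ∈-deduplicate⁺; ∈-deduplicate⁻)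
  open import Data.List.Relation.Unary.All as All using (All)
  open import Data.List.Relation.Unary.Unique.Propositional.Properties using (map⁺; allFin⁺)
  open import Data.List.Relation.Unary.Unique.DecPropositional.Properties (≡-dec ℕ._≟_) using (deduplicate-!)
  open import Data.List.Relation.Unary.Sorted.TotalOrder (ℕₚ.≤-totalOrder) using (Sorted)
  open import Data.List.Sort.Base using (SortingAlgorithm)
  open import Data.List.Sort.MergeSort ℕₚ.≤-decTotalOrder using (mergeSort)
  open import Data.Product using (∃-syntax; _×_; _,_; proj₁; proj₂)
  open import Relation.Binary.PropositionalEquality
  open import Relation.Nullary using (Dec; yes; no; does; _×-dec_)
  open import Relation.Nullary.Decidable using (dec-true; does-⇔)
  open import Data.Nat.Tactic.RingSolver using (solve-∀)

  _≟ᴸ_ : (xs ys : List ℕ) → Dec (xs ≡ ys)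
  _≟ᴸ_ = ≡-dec ℕ._≟_

  tally : (ℕ × ℕ → ℤ) → Store → ℤ
  tally ψ D = sumℤ (map ψ D)

  tally-++ : ∀ ψ D E → tally ψ (D ++ E) ≡ tally ψ D + tally ψ E
  tally-++ ψ []      E = sym (ℤₚ.+-identityˡ (tally ψ E))
  tally-++ ψ (p ∷ D) E = trans (cong (_+_ (ψ p)) (tally-++ ψ D E)) (sym (ℤₚ.+-assoc (ψ p) _ _))

  tally-concatMap : ∀ {A : Set} ψ (g : A → Store) as →
                    tally ψ (concatMap g as) ≡ sumℤ (map (λ a → tally ψ (g a)) as)
  tally-concatMap ψ g []       = refl
  tally-concatMap ψ g (a ∷ as) = trans (tally-++ ψ (g a) _) (cong (_+_ (tally ψ (g a))) (tally-concatMap ψ g as))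

  countTally : ℕ → ℕ → ℕ × ℕ → ℤ
  countTally key w (k , v) = 𝟙 (k ≡ᵇ key) * 𝟙 (v ≡ᵇ w)

  lengthTally : ℕ → ℕ × ℕ → ℤ
  lengthTally key (k , _) = 𝟙 (k ≡ᵇ key)

  tally-count : ∀ key w D → tally (countTally key w) D ≡ + count w (valuesAt key D)
  tally-count key w []            = refl
  tally-count key w ((k , v) ∷ D) with k ≡ᵇ key
  ... | false = trans (ℤₚ.+-identityˡ _) (tally-count key w D)
  ... | true with v ≡ᵇ w
  ...   | true  = cong (_+_ (+ 1)) (tally-count key w D)
  ...   | false = trans (ℤₚ.+-identityˡ _) (tally-count key w D)

  tally-length : ∀ key D → tally (lengthTally key) D ≡ + length (valuesAt key D)
  tally-length key []            = refl
  tally-length key ((k , v) ∷ D) with k ≡ᵇ key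
  ... | false = trans (ℤₚ.+-identityˡ _) (tally-length key D)
  ... | true  = cong (_+_ (+ 1)) (tally-length key D)

  length-valuesAt : ∀ key D → length (valuesAt key D) ≡ count key (map proj₁ D)
  length-valuesAt key []            = refl
  length-valuesAt key ((k , v) ∷ D) with k ≡ᵇ key
  ... | false = length-valuesAt key D
  ... | true  = cong suc (length-valuesAt key D)

  length-valuesAt-store₀ : ∀ n x key → length (valuesAt key (store₀ n x)) ≤ 1
  length-valuesAt-store₀ n x key = subst (_≤ 1) (sym (length-valuesAt key (store₀ n x)))
    (subst (λ ks → count key ks ≤ 1) (map-∘ (allFin (N n)))
      (count-unique key (map⁺ Finₚ.toℕ-injective (allFin⁺ (N n)))))

  𝟙-sortℕ≡ : ∀ xs {ys} → Sorted ys →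
             𝟙 (does (sortℕ xs ≟ᴸ ys))
             ≡ productℤ (map (λ v → 𝟙 (count v xs ≡ᵇ count v ys)) ys) * 𝟙 (length xs ≡ᵇ length ys)
  𝟙-sortℕ≡ xs {ys} ys↗ = begin
    𝟙 (does (sortℕ xs ≟ᴸ ys))
      ≡⟨ cong 𝟙 (does-⇔ (sortℕ≡⇔ xs ys↗) (sortℕ xs ≟ᴸ ys) (counts? ×-dec (length xs ℕ.≟ length ys))) ⟩
    𝟙 (does counts? Data.Bool.∧ (length xs ≡ᵇ length ys))
      ≡⟨ 𝟙-∧ (does counts?) (length xs ≡ᵇ length ys) ⟩
    𝟙 (does counts?) * 𝟙 (length xs ≡ᵇ length ys)
      ≡⟨ cong (_* 𝟙 (length xs ≡ᵇ length ys)) (𝟙-all (λ v → count v xs ℕ.≟ count v ys) ys) ⟨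
    productℤ (map (λ v → 𝟙 (count v xs ≡ᵇ count v ys)) ys) * 𝟙 (length xs ≡ᵇ length ys) ∎
    where
    open ≡-Reasoning
    counts? : Dec (All (λ v → count v xs ≡ count v ys) ys)
    counts? = All.all? (λ v → count v xs ℕ.≟ count v ys) ys

  length≤cost : ∀ M → length M ≤ cost M
  length≤cost []      = z≤n
  length≤cost (_ ∷ _) = ℕₚ.≤-refl

  1≤cost : ∀ M → 1 ≤ cost M
  1≤cost []      = s≤s z≤n
  1≤cost (_ ∷ _) = s≤s z≤n

  query-budget : ∀ {ℓ c b} x → ℓ ≤ c → 1 ≤ c → c ≤ b →
                 ℓ ℕ.* x ℕ.+ x ℕ.+ (b ∸ c) ℕ.* (2 ℕ.* x) ≤ b ℕ.* (2 ℕ.* x)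
  query-budget {ℓ} {c} {b} x ℓ≤c 1≤c c≤b = begin
    ℓ ℕ.* x ℕ.+ x ℕ.+ (b ∸ c) ℕ.* (2 ℕ.* x)
      ≤⟨ ℕₚ.+-monoˡ-≤ _ (ℕₚ.+-mono-≤ (ℕₚ.*-monoˡ-≤ x ℓ≤c) (ℕₚ.m≤n*m x c {{ℕ.>-nonZero 1≤c}})) ⟩
    c ℕ.* x ℕ.+ c ℕ.* x ℕ.+ (b ∸ c) ℕ.* (2 ℕ.* x)
      ≡⟨ cong (ℕ._+ (b ∸ c) ℕ.* (2 ℕ.* x)) (double c x) ⟩
    c ℕ.* (2 ℕ.* x) ℕ.+ (b ∸ c) ℕ.* (2 ℕ.* x)
      ≡⟨ ℕₚ.*-distribʳ-+ (2 ℕ.* x) c (b ∸ c) ⟨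
    (c ℕ.+ (b ∸ c)) ℕ.* (2 ℕ.* x)
      ≡⟨ cong (ℕ._* (2 ℕ.* x)) (ℕₚ.m+[n∸m]≡n c≤b) ⟩
    b ℕ.* (2 ℕ.* x) ∎
    where
    open ℕₚ.≤-Reasoning
    double : ∀ c x → c ℕ.* x ℕ.+ c ℕ.* x ≡ c ℕ.* (2 ℕ.* x)
    double = solve-∀

  roundDegree : ℕ → ℕ → ℕ → ℕ
  roundDegree S d₀ zero    = d₀
  roundDegree S d₀ (suc r) = S ℕ.* (2 ℕ.* (S ℕ.* roundDegree S d₀ r))

  module Rounds (S : ℕ) (A : Algorithm) {n k : ℕ} (X : Cube k → Input n) where
    open Algorithm A

    storeAt : ℕ → Cube k → Store
    storeAt r y = store S A n (X y) r

    InputBitsAreJuntas : ℕ → Set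
    InputBitsAreJuntas d₀ = ∀ i → ∃[ p ] (∣ p ∣ ≤ d₀ × DependsOnlyOn p (λ y → X y i))

    record Bounded (r d : ℕ) : Set where
      field
        tally-Deg≤ : ∀ ψ → Deg≤ d (λ y → tally ψ (storeAt r y))
        load≤S     : ∀ y key → length (valuesAt key (storeAt r y)) ≤ S

    module _ {r d : ℕ} (bounded : Bounded r d) where
      open Bounded bounded

      private
        values : ℕ → Cube k → List ℕ
        values key y = valuesAt key (storeAt r y)

        response-Deg≤ : ∀ key {M} → Sorted M →
          Deg≤ (length M ℕ.* (S ℕ.* d) ℕ.+ S ℕ.* d) (λ y → 𝟙 (does (response key (storeAt r y) ≟ᴸ M)))
        response-Deg≤ key {M} M↗ = Deg≤-cong (λ y → sym (𝟙-sortℕ≡ (values key y) M↗)) (Deg≤-*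
          (Deg≤-product (λ v y → 𝟙 (count v (values key y) ≡ᵇ count v M)) M (All.tabulate λ {v} _ →
            Deg≤-𝟙-≡ᵇ (λ y → count v (values key y))
              (λ y → ℕₚ.≤-trans (length-filter (ℕ._≟ v) (values key y)) (load≤S y key))
              (Deg≤-cong (λ y → tally-count key v (storeAt r y)) (tally-Deg≤ (countTally key v)))
              (count v M)))
          (Deg≤-𝟙-≡ᵇ (λ y → length (values key y)) (λ y → load≤S y key)
            (Deg≤-cong (λ y → tally-length key (storeAt r y)) (tally-Deg≤ (lengthTally key)))
            (length M)))

        afterResponse : ℕ → (List ℕ → Strategy) → (ℕ × ℕ → ℤ) → List ℕ → Store → ℤ
        afterResponse b f ψ M D with cost M ≤? b
        ... | yes _ = tally ψ (run (b ∸ cost M) (f M) D)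
        ... | no  _ = 0ℤ

        run-query : ∀ b key f ψ D → tally ψ (run b (query key f) D) ≡ afterResponse b f ψ (response key D) D
        run-query b key f ψ D with cost (response key D) ≤? b
        ... | yes _ = refl
        ... | no  _ = refl

      run-Deg≤ : ∀ s b ψ → Deg≤ (b ℕ.* (2 ℕ.* (S ℕ.* d))) (λ y → tally ψ (run b s (storeAt r y)))
      run-Deg≤ (write w)     b ψ = Deg≤-weaken z≤n (Deg≤-const (tally ψ w))
      run-Deg≤ (query key f) b ψ =
        Deg≤-cong select (Deg≤-sum branch responses (All.tabulate λ M∈ → branch-Deg≤ (response-sorted M∈)))
        where
        responses : List (List ℕ)
        responses = deduplicate _≟ᴸ_ (map (λ y → response key (storeAt r y)) (allCube k))

        branch : List ℕ → Cube k → ℤ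
        branch M y = 𝟙 (does (response key (storeAt r y) ≟ᴸ M)) * afterResponse b f ψ M (storeAt r y)

        -- The continuation depends on y only through the response, which takes finitely many values.
        select : ∀ y → sumℤ (map (λ M → branch M y) responses) ≡ tally ψ (run b (query key f) (storeAt r y))
        select y = trans
          (sumℤ-select _≟ᴸ_ (λ M → afterResponse b f ψ M (storeAt r y)) (response key (storeAt r y))
            (deduplicate-! _) (∈-deduplicate⁺ _≟ᴸ_ (∈-map⁺ (λ y → response key (storeAt r y)) (∈-allCube y))))
          (sym (run-query b key f ψ (storeAt r y)))

        response-sorted : ∀ {M} → M ∈ responses → Sorted M
        response-sorted M∈ with y , _ , refl ← ∈-map⁻ _ (∈-deduplicate⁻ _≟ᴸ_ _ M∈) =
          SortingAlgorithm.sort-↗ mergeSort (values key y)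

        branch-Deg≤ : ∀ {M} → Sorted M → Deg≤ (b ℕ.* (2 ℕ.* (S ℕ.* d))) (branch M)
        branch-Deg≤ {M} M↗ with cost M ≤? b
        ... | no _ = Deg≤-cong (λ y → sym (ℤₚ.*-zeroʳ (𝟙 (does (response key (storeAt r y) ≟ᴸ M)))))
                       (Deg≤-weaken z≤n (Deg≤-const 0ℤ))
        ... | yes cost≤b = Deg≤-weaken (query-budget (S ℕ.* d) (length≤cost M) (1≤cost M) cost≤b)
                             (Deg≤-* (response-Deg≤ key M↗) (run-Deg≤ (f M) (b ∸ cost M) ψ))

    bounded-0 : ∀ {d₀} → 1 ≤ S → InputBitsAreJuntas d₀ → Bounded 0 d₀
    bounded-0 {d₀} 1≤S bit-junta = record
      { tally-Deg≤ = λ ψ → Deg≤-cong (λ y → cong sumℤ (map-∘ (allFin (N n))))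
          (Deg≤-sum (λ i y → ψ (toℕ i , bit (X y i))) (allFin (N n)) (All.tabulate λ {i} _ → entry i ψ))
      ; load≤S = λ y key → ℕₚ.≤-trans (length-valuesAt-store₀ n (X y) key) 1≤S
      }
      where
      entry : ∀ i ψ → Deg≤ d₀ (λ y → ψ (toℕ i , bit (X y i)))
      entry i ψ with p , ∣p∣≤d₀ , Xi-on-p ← bit-junta i =
        Deg≤-junta ∣p∣≤d₀ (λ y y′ eq → cong (λ b → ψ (toℕ i , bit b)) (Xi-on-p y y′ eq))

    bounded-suc : ∀ {R r d} → Valid S A n R → r < R → Bounded r d → Bounded (suc r) (S ℕ.* (2 ℕ.* (S ℕ.* d)))
    bounded-suc {r = r} valid r<R bounded = record
      { tally-Deg≤ = λ ψ → Deg≤-cong (λ y → sym (tally-concatMap ψ (output S A n (X y) r) (allFin (machines r))))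
          (Deg≤-sum (λ j y → tally ψ (output S A n (X y) r j)) (allFin (machines r))
            (All.tabulate λ {j} _ → run-Deg≤ bounded (strategy r j) S ψ))
      ; load≤S = λ y → proj₂ (valid (X y) r r<R)
      }

    module _ {d₀ R : ℕ} (1≤S : 1 ≤ S) (bit-junta : InputBitsAreJuntas d₀) (valid : Valid S A n R) where

      bounded : ∀ r → r ≤ R → Bounded r (roundDegree S d₀ r)
      bounded zero    _   = bounded-0 1≤S bit-junta
      bounded (suc r) r<R = bounded-suc valid r<R (bounded r (ℕₚ.<⇒≤ r<R))

      parity-lowerBound : ∀ ans → (∀ y → storeAt R y ≡ (ans , bit (parity y)) ∷ []) → k ≤ roundDegree S d₀ R
      parity-lowerBound ans answers =
        parity-Deg≤ (Deg≤-cong read (Bounded.tally-Deg≤ (bounded R ℕₚ.≤-refl) (countTally ans 1)))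
        where
        ans≡ᵇans : (ans ≡ᵇ ans) ≡ true
        ans≡ᵇans = dec-true (ans ℕ.≟ ans) refl
        read : ∀ y → tally (countTally ans 1) (storeAt R y) ≡ 𝟙 (parity y)
        read y rewrite answers y | ans≡ᵇans with parity y
        ... | true  = refl
        ... | false = refl

module CycleGadget where

  open CubeDegree using (Cube; parity; DependsOnlyOn; ∣p∪q∣≤∣p∣+∣q∣)
  open import Data.Nat as ℕ using (ℕ; zero; suc; _<_; _≡ᵇ_; z≤n; s≤s)
  import Data.Nat.Properties as ℕₚ
  open import Data.Nat.DivMod using (_%_; m<n⇒m%n≡m; n%n≡0)
  open import Data.Bool using (Bool; true; false; _∧_; _∨_; _xor_)
  import Data.Bool.Properties as Boolₚ
  open import Data.Fin as Fin using (Fin; zero; suc; toℕ; combine; remQuot)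
  import Data.Fin.Properties as Finₚ
  open import Data.Vec as Vec using ([]; _∷_)
  open import Data.Fin.Subset using (∣_∣; ⁅_⁆; _∪_)
  open import Data.Fin.Subset.Properties using (∣⁅x⁆∣≡1; x∈⁅x⁆; p⊆p∪q; q⊆p∪q)
  open import Data.List using (List; map; filter; allFin; lookup)
  open import Data.List.Membership.Propositional using (_∈_; lose)
  open import Data.List.Membership.Propositional.Properties
    using (∈-concatMap⁺; ∈-concatMap⁻; ∈-map⁺; ∈-map⁻; ∈-filter⁺; ∈-filter⁻; ∈-allFin; ∈-lookup)
  open import Data.List.Relation.Unary.Any as Any using (index)
  open import Data.List.Relation.Unary.Any.Properties using (lookup-index)
  open import Data.Product as Product using (∃-syntax; _×_; _,_; proj₁; proj₂)
  open import Data.Sum using (_⊎_; inj₁; inj₂)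
  open import Function using (_∘_; _⇔_; mk⇔; Equivalence)
  open import Function.Definitions using (Injective)
  open import Relation.Binary.Definitions using (tri<; tri≈; tri>)
  open import Relation.Binary.PropositionalEquality
  open import Relation.Nullary using (yes; no; does; contradiction)
  open import Relation.Nullary.Decidable using (dec-true; dec-false)

  private
    row : ∀ n → Fin n → List (Fin n × Fin n)
    row n v = map (λ u → (u , v)) (filter (λ u → u Fin.<? v) (allFin n))

  ∈-pairs⁺ : ∀ {n} {u v : Fin n} → u Fin.< v → (u , v) ∈ pairs n
  ∈-pairs⁺ {n} {u} {v} u<v = ∈-concatMap⁺ (row n) {xs = allFin n}
    (lose (∈-allFin v) (∈-map⁺ (_, v) (∈-filter⁺ (Fin._<? v) (∈-allFin u) u<v)))

  ∈-pairs⁻ : ∀ {n} {u v : Fin n} → (u , v) ∈ pairs n → u Fin.< v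
  ∈-pairs⁻ {n} uv∈ with v′ , uv∈row ← Any.satisfied (∈-concatMap⁻ (row n) {xs = allFin n} uv∈)
                    with u′ , u′∈ , refl ← ∈-map⁻ (_, v′) uv∈row =
    proj₂ (∈-filter⁻ (Fin._<? v′) {xs = allFin n} u′∈)

  encode : ∀ {n} → (Fin n → Fin n → Bool) → Input n
  encode {n} E i = E (proj₁ (lookup (pairs n) i)) (proj₂ (lookup (pairs n) i))

  Adj-encode : ∀ {n} (E : Fin n → Fin n → Bool) → (∀ u v → E u v ≡ E v u) →
               ∀ u v → Adj n (encode E) u v ⇔ (u ≢ v × E u v ≡ true)
  Adj-encode {n} E E-sym u v = mk⇔ to from
    where
    bit⇒ : ∀ {u v} → Bit n (encode E) u v → u Fin.< v × E u v ≡ true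
    bit⇒ (i , refl , Ei) = ∈-pairs⁻ (∈-lookup i) , Ei
    bit⇐ : ∀ {u v} → u Fin.< v → E u v ≡ true → Bit n (encode E) u v
    bit⇐ {u} {v} u<v Euv = index uv∈ , sym (lookup-index uv∈) ,
      subst (λ p → E (proj₁ p) (proj₂ p) ≡ true) (lookup-index uv∈) Euv
      where
      uv∈ : (u , v) ∈ pairs n
      uv∈ = ∈-pairs⁺ u<v
    to : Adj n (encode E) u v → u ≢ v × E u v ≡ true
    to (inj₁ b) with u<v , Euv ← bit⇒ b = Finₚ.<⇒≢ u<v , Euv
    to (inj₂ b) with v<u , Evu ← bit⇒ b = (λ u≡v → Finₚ.<⇒≢ v<u (sym u≡v)) , trans (E-sym u v) Evu
    from : u ≢ v × E u v ≡ true → Adj n (encode E) u v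
    from (u≢v , Euv) with Finₚ.<-cmp u v
    ... | tri< u<v _ _ = inj₁ (bit⇐ u<v Euv)
    ... | tri≈ _ u≡v _ = contradiction u≡v u≢v
    ... | tri> _ _ v<u = inj₂ (bit⇐ v<u (trans (E-sym v u) Euv))

  successorGraph : ∀ {n} → (Fin n → Fin n) → Fin n → Fin n → Bool
  successorGraph succ u v = does (v Fin.≟ succ u) ∨ does (u Fin.≟ succ v)

  Adj-successorGraph : ∀ {n} (succ : Fin n → Fin n) → (∀ u → succ u ≢ u) →
                       ∀ u v → Adj n (encode (successorGraph succ)) u v ⇔ (v ≡ succ u ⊎ u ≡ succ v)
  Adj-successorGraph succ succ≢ u v = mk⇔
    (λ adj → edge⇒ (proj₂ (Equivalence.to (Adj-encode E E-sym u v) adj)))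
    (λ e → Equivalence.from (Adj-encode E E-sym u v) (distinct e , edge⇐ e))
    where
    E : Fin _ → Fin _ → Bool
    E = successorGraph succ
    E-sym : ∀ u v → E u v ≡ E v u
    E-sym u v = Boolₚ.∨-comm (does (v Fin.≟ succ u)) (does (u Fin.≟ succ v))
    edge⇒ : E u v ≡ true → v ≡ succ u ⊎ u ≡ succ v
    edge⇒ Euv with v Fin.≟ succ u | u Fin.≟ succ v
    ... | yes v≡ | _      = inj₁ v≡
    ... | no _   | yes u≡ = inj₂ u≡
    edge⇐ : v ≡ succ u ⊎ u ≡ succ v → E u v ≡ true
    edge⇐ (inj₁ v≡) = cong (_∨ does (u Fin.≟ succ v)) (dec-true (v Fin.≟ succ u) v≡)
    edge⇐ (inj₂ u≡) = trans (cong (does (v Fin.≟ succ u) ∨_) (dec-true (u Fin.≟ succ v) u≡))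
                            (Boolₚ.∨-zeroʳ (does (v Fin.≟ succ u)))
    distinct : v ≡ succ u ⊎ u ≡ succ v → u ≢ v
    distinct (inj₁ refl) u≡ = succ≢ u (sym u≡)
    distinct (inj₂ refl) u≡ = succ≢ v u≡

  CycleEdge : ∀ {I V : Set} → (I → I) → (I → V) → V → V → Set
  CycleEdge nextᴵ σ u v = ∃[ i ] ((σ i ≡ u × σ (nextᴵ i) ≡ v) ⊎ (σ i ≡ v × σ (nextᴵ i) ≡ u))

  successor⇔cycleEdge : ∀ {I V : Set} (nextᴵ : I → I) (succ : V → V) (σ : I → V) (σ⁻¹ : V → I) →
    (∀ v → σ (σ⁻¹ v) ≡ v) → (∀ i → succ (σ i) ≡ σ (nextᴵ i)) →
    ∀ u v → (v ≡ succ u ⊎ u ≡ succ v) ⇔ CycleEdge nextᴵ σ u v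
  successor⇔cycleEdge nextᴵ succ σ σ⁻¹ σσ⁻¹ commute u v = mk⇔ to from
    where
    around : ∀ {a b} → b ≡ succ a → σ (σ⁻¹ a) ≡ a × σ (nextᴵ (σ⁻¹ a)) ≡ b
    around {a} refl = σσ⁻¹ a , trans (sym (commute (σ⁻¹ a))) (cong succ (σσ⁻¹ a))
    to : v ≡ succ u ⊎ u ≡ succ v → CycleEdge nextᴵ σ u v
    to (inj₁ v≡) = σ⁻¹ u , inj₁ (around v≡)
    to (inj₂ u≡) = σ⁻¹ v , inj₂ (around u≡)
    from : CycleEdge nextᴵ σ u v → v ≡ succ u ⊎ u ≡ succ v
    from (i , inj₁ (refl , refl)) = inj₁ (sym (commute i))
    from (i , inj₂ (refl , refl)) = inj₂ (sym (commute i))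

  successorGraph-cycleEdges : ∀ {n} {I : Set} (nextᴵ : I → I) (succ : Fin n → Fin n) (σ : I → Fin n) (σ⁻¹ : Fin n → I) →
    (∀ u → succ u ≢ u) → (∀ v → σ (σ⁻¹ v) ≡ v) → (∀ i → succ (σ i) ≡ σ (nextᴵ i)) →
    (u v : Fin n) → (Adj n (encode (successorGraph succ)) u v → CycleEdge nextᴵ σ u v)
                  × (CycleEdge nextᴵ σ u v → Adj n (encode (successorGraph succ)) u v)
  successorGraph-cycleEdges nextᴵ succ σ σ⁻¹ succ≢ σσ⁻¹ commute u v =
    Equivalence.to cycle ∘ Equivalence.to adj , Equivalence.from adj ∘ Equivalence.from cycle
    where
    adj : Adj _ (encode (successorGraph succ)) u v ⇔ (v ≡ succ u ⊎ u ≡ succ v)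
    adj = Adj-successorGraph succ succ≢ u v
    cycle : (v ≡ succ u ⊎ u ≡ succ v) ⇔ CycleEdge nextᴵ σ u v
    cycle = successor⇔cycleEdge nextᴵ succ σ σ⁻¹ σσ⁻¹ commute u v

  toℕ-next-< : ∀ {N} (i : Fin (suc N)) → suc (toℕ i) < suc N → toℕ (next i) ≡ suc (toℕ i)
  toℕ-next-< i 1+i<1+N = trans (Finₚ.toℕ-fromℕ< _) (m<n⇒m%n≡m 1+i<1+N)

  toℕ-next-last : ∀ {N} (i : Fin (suc N)) → suc (toℕ i) ≡ suc N → toℕ (next i) ≡ 0
  toℕ-next-last {N} i 1+i≡1+N = trans (Finₚ.toℕ-fromℕ< _) (trans (cong (_% suc N) 1+i≡1+N) (n%n≡0 (suc N)))

  next≢ : ∀ {N} (i : Fin (suc (suc N))) → next i ≢ i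
  next≢ i next≡i with ℕₚ.m≤n⇒m<n∨m≡n (Finₚ.toℕ<n i)
  ... | inj₁ inner = ℕₚ.1+n≢n (trans (sym (toℕ-next-< i inner)) (cong toℕ next≡i))
  ... | inj₂ last  = ℕₚ.0≢1+n (trans (sym (trans (cong toℕ (sym next≡i)) (toℕ-next-last i last)))
                                     (ℕₚ.suc-injective last))

  flipIf : Bool → Fin 2 → Fin 2
  flipIf false h          = h
  flipIf true  zero       = suc zero
  flipIf true  (suc zero) = zero

  flipIf-flipIf : ∀ a b h → flipIf a (flipIf b h) ≡ flipIf (b xor a) h
  flipIf-flipIf false false h          = refl
  flipIf-flipIf false true  h          = refl
  flipIf-flipIf true  false h          = refl
  flipIf-flipIf true  true  zero       = refl
  flipIf-flipIf true  true  (suc zero) = refl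

  prefixParity : ∀ {k} → Cube k → ℕ → Bool
  prefixParity y       zero    = false
  prefixParity []      (suc j) = false
  prefixParity (b ∷ y) (suc j) = b xor prefixParity y j

  prefixParity-suc : ∀ {k} (y : Cube k) (j : Fin k) →
                     prefixParity y (suc (toℕ j)) ≡ prefixParity y (toℕ j) xor Vec.lookup y j
  prefixParity-suc (b ∷ y) zero    = Boolₚ.xor-identityʳ b
  prefixParity-suc (b ∷ y) (suc j) = trans (cong (b xor_) (prefixParity-suc y j))
                                           (sym (Boolₚ.xor-assoc b (prefixParity y (toℕ j)) (Vec.lookup y j)))

  prefixParity-total : ∀ {k} (y : Cube k) → prefixParity y k ≡ parity y
  prefixParity-total []      = refl
  prefixParity-total (b ∷ y) = cong (b xor_) (prefixParity-total y)

  -- Vertex (h , j), on strand h in column j, is numbered h * M + j.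
  module Gadget (m : ℕ) where

    M : ℕ
    M = suc (suc m)

    Coord : Set
    Coord = Fin 2 × Fin M

    label : Coord → Fin (2 ℕ.* M)
    label (h , j) = combine h j

    coords : Fin (2 ℕ.* M) → Coord
    coords = remQuot M

    label∘coords : ∀ t → label (coords t) ≡ t
    label∘coords = Finₚ.combine-remQuot M

    coords∘label : ∀ c → coords (label c) ≡ c
    coords∘label (h , j) = Finₚ.remQuot-combine h j

    step : Cube M → Coord → Coord
    step y (h , j) = flipIf (Vec.lookup y j) h , next j

    succ : Cube M → Fin (2 ℕ.* M) → Fin (2 ℕ.* M)
    succ y = label ∘ step y ∘ coords

    input : Cube M → Input (2 ℕ.* M)
    input y = encode (successorGraph (succ y))

    succ≢ : ∀ y t → succ y t ≢ t
    succ≢ y t succ≡t = next≢ (proj₂ (coords t))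
      (cong proj₂ (trans (sym (coords∘label (step y (coords t)))) (cong coords succ≡t)))

    column : Fin (2 ℕ.* M) → Fin M
    column = proj₂ ∘ coords

    succ-local : ∀ y y′ t → Vec.lookup y (column t) ≡ Vec.lookup y′ (column t) → succ y t ≡ succ y′ t
    succ-local y y′ t eq = cong (λ b → label (flipIf b (proj₁ (coords t)) , next (column t))) eq

    input-junta : ∀ i → ∃[ p ] (∣ p ∣ ℕ.≤ 2 × DependsOnlyOn p (λ y → input y i))
    input-junta i = ⁅ column u ⁆ ∪ ⁅ column v ⁆ ,
      ℕₚ.≤-trans (∣p∪q∣≤∣p∣+∣q∣ ⁅ column u ⁆ ⁅ column v ⁆)
                 (ℕₚ.≤-reflexive (cong₂ ℕ._+_ (∣⁅x⁆∣≡1 (column u)) (∣⁅x⁆∣≡1 (column v)))) ,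
      λ y y′ agree → cong₂ (λ su sv → does (v Fin.≟ su) ∨ does (u Fin.≟ sv))
        (succ-local y y′ u (agree (p⊆p∪q ⁅ column v ⁆ (x∈⁅x⁆ (column u)))))
        (succ-local y y′ v (agree (q⊆p∪q ⁅ column u ⁆ ⁅ column v ⁆ (x∈⁅x⁆ (column v)))))
      where
      u v : Fin (2 ℕ.* M)
      u = proj₁ (lookup (pairs (2 ℕ.* M)) i)
      v = proj₂ (lookup (pairs (2 ℕ.* M)) i)

    relabel : Cube M → Coord → Coord
    relabel y (h , j) = flipIf (prefixParity y (toℕ j)) h , j

    relabel-involutive : ∀ y c → relabel y (relabel y c) ≡ c
    relabel-involutive y (h , j) = cong (_, j) (trans (flipIf-flipIf s s h) (cong (λ b → flipIf b h) (Boolₚ.xor-same s)))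
      where
      s : Bool
      s = prefixParity y (toℕ j)

    isLast : Fin M → Bool
    isLast j = suc (toℕ j) ≡ᵇ M

    turn : Bool → Coord → Coord
    turn p (h , j) = flipIf (isLast j ∧ p) h , next j

    turn-inner : ∀ p h j → suc (toℕ j) < M → turn p (h , j) ≡ (h , next j)
    turn-inner p h j inner = cong (λ b → flipIf (b ∧ p) h , next j) isLast≡false
      where
      isLast≡false : isLast j ≡ false
      isLast≡false = dec-false (suc (toℕ j) ℕ.≟ M) (ℕₚ.<⇒≢ inner)

    turn-last : ∀ p h j → suc (toℕ j) ≡ M → turn p (h , j) ≡ (flipIf p h , next j)
    turn-last p h j last = cong (λ b → flipIf (b ∧ p) h , next j) isLast≡true
      where
      isLast≡true : isLast j ≡ true
      isLast≡true = dec-true (suc (toℕ j) ℕ.≟ M) last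

    turn-false : ∀ h j → turn false (h , j) ≡ (h , next j)
    turn-false h j = cong (λ b → flipIf b h , next j) (Boolₚ.∧-zeroʳ (isLast j))

    -- The relabelling absorbs all switches but the total one, which happens on wrapping around.
    step-relabel : ∀ y c → step y (relabel y c) ≡ relabel y (turn (parity y) c)
    step-relabel y (h , j) with ℕₚ.m≤n⇒m<n∨m≡n (Finₚ.toℕ<n j)
    ... | inj₁ inner = begin
      flipIf yⱼ (flipIf (s (toℕ j)) h) , next j ≡⟨ cong (_, next j) (flipIf-flipIf yⱼ (s (toℕ j)) h) ⟩
      flipIf (s (toℕ j) xor yⱼ) h , next j     ≡⟨ cong (λ b → flipIf b h , next j) (prefixParity-suc y j) ⟨
      flipIf (s (suc (toℕ j))) h , next j      ≡⟨ cong (λ t → flipIf (s t) h , next j) (toℕ-next-< j inner) ⟨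
      relabel y (h , next j)                   ≡⟨ cong (relabel y) (turn-inner (parity y) h j inner) ⟨
      relabel y (turn (parity y) (h , j))      ∎
      where
      open ≡-Reasoning
      s : ℕ → Bool
      s = prefixParity y
      yⱼ : Bool
      yⱼ = Vec.lookup y j
    ... | inj₂ last  = begin
      flipIf yⱼ (flipIf (s (toℕ j)) h) , next j ≡⟨ cong (_, next j) (flipIf-flipIf yⱼ (s (toℕ j)) h) ⟩
      flipIf (s (toℕ j) xor yⱼ) h , next j     ≡⟨ cong (λ b → flipIf b h , next j) (prefixParity-suc y j) ⟨
      flipIf (s (suc (toℕ j))) h , next j      ≡⟨ cong (λ t → flipIf (s t) h , next j) last ⟩
      flipIf (s M) h , next j                  ≡⟨ cong (λ b → flipIf b h , next j) (prefixParity-total y) ⟩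
      flipIf (parity y) h , next j             ≡⟨ cong (λ t → flipIf (s t) (flipIf (parity y) h) , next j) (toℕ-next-last j last) ⟨
      relabel y (flipIf (parity y) h , next j) ≡⟨ cong (relabel y) (turn-last (parity y) h j last) ⟨
      relabel y (turn (parity y) (h , j))      ∎
      where
      open ≡-Reasoning
      s : ℕ → Bool
      s = prefixParity y
      yⱼ : Bool
      yⱼ = Vec.lookup y j

    toℕ-label₀ : ∀ j → toℕ (label (zero , j)) ≡ toℕ j
    toℕ-label₀ j = Finₚ.toℕ-↑ˡ j (1 ℕ.* M)

    toℕ-label₁ : ∀ j → toℕ (label (suc zero , j)) ≡ M ℕ.+ toℕ j
    toℕ-label₁ j = trans (Finₚ.toℕ-↑ʳ M _) (cong (M ℕ.+_) (Finₚ.toℕ-↑ˡ j (0 ℕ.* M)))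

    M+M≡2*M : M ℕ.+ M ≡ 2 ℕ.* M
    M+M≡2*M = cong (M ℕ.+_) (sym (ℕₚ.+-identityʳ M))

    next-label : ∀ c → next (label c) ≡ label (turn true c)
    next-label (h , j) with ℕₚ.m≤n⇒m<n∨m≡n (Finₚ.toℕ<n j)
    ... | inj₁ inner = trans (Finₚ.toℕ-injective (inner-case h)) (cong label (sym (turn-inner true h j inner)))
      where
      open ≡-Reasoning
      inner-case : ∀ h → toℕ (next (label (h , j))) ≡ toℕ (label (h , next j))
      inner-case zero = begin
        toℕ (next (label (zero , j)))  ≡⟨ toℕ-next-< (label (zero , j))
                                            (subst (λ t → suc t < 2 ℕ.* M) (sym (toℕ-label₀ j))
                                              (ℕₚ.<-≤-trans inner (ℕₚ.m≤m+n M (M ℕ.+ 0)))) ⟩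
        suc (toℕ (label (zero , j)))   ≡⟨ cong suc (toℕ-label₀ j) ⟩
        suc (toℕ j)                    ≡⟨ toℕ-next-< j inner ⟨
        toℕ (next j)                   ≡⟨ toℕ-label₀ (next j) ⟨
        toℕ (label (zero , next j))    ∎
      inner-case (suc zero) = begin
        toℕ (next (label (suc zero , j))) ≡⟨ toℕ-next-< (label (suc zero , j))
                                               (subst (λ t → suc t < 2 ℕ.* M) (sym (toℕ-label₁ j))
                                                 (subst (suc (M ℕ.+ toℕ j) <_) M+M≡2*M
                                                   (subst (_< M ℕ.+ M) (ℕₚ.+-suc M (toℕ j)) (ℕₚ.+-monoʳ-< M inner)))) ⟩
        suc (toℕ (label (suc zero , j)))  ≡⟨ cong suc (toℕ-label₁ j) ⟩
        suc (M ℕ.+ toℕ j)                 ≡⟨ ℕₚ.+-suc M (toℕ j) ⟨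
        M ℕ.+ suc (toℕ j)                 ≡⟨ cong (M ℕ.+_) (toℕ-next-< j inner) ⟨
        M ℕ.+ toℕ (next j)                ≡⟨ toℕ-label₁ (next j) ⟨
        toℕ (label (suc zero , next j))   ∎
    ... | inj₂ last = trans (Finₚ.toℕ-injective (last-case h)) (cong label (sym (turn-last true h j last)))
      where
      open ≡-Reasoning
      last-case : ∀ h → toℕ (next (label (h , j))) ≡ toℕ (label (flipIf true h , next j))
      last-case zero = begin
        toℕ (next (label (zero , j)))  ≡⟨ toℕ-next-< (label (zero , j))
                                            (subst (λ t → suc t < 2 ℕ.* M) (sym (toℕ-label₀ j))
                                              (subst (_< 2 ℕ.* M) (sym last) (ℕₚ.m<m+n M (s≤s z≤n)))) ⟩
        suc (toℕ (label (zero , j)))   ≡⟨ cong suc (toℕ-label₀ j) ⟩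
        suc (toℕ j)                    ≡⟨ last ⟩
        M                              ≡⟨ ℕₚ.+-identityʳ M ⟨
        M ℕ.+ 0                        ≡⟨ cong (M ℕ.+_) (toℕ-next-last j last) ⟨
        M ℕ.+ toℕ (next j)             ≡⟨ toℕ-label₁ (next j) ⟨
        toℕ (label (suc zero , next j)) ∎
      last-case (suc zero) = begin
        toℕ (next (label (suc zero , j))) ≡⟨ toℕ-next-last (label (suc zero , j)) (begin
                                               suc (toℕ (label (suc zero , j))) ≡⟨ cong suc (toℕ-label₁ j) ⟩
                                               suc (M ℕ.+ toℕ j)                ≡⟨ ℕₚ.+-suc M (toℕ j) ⟨
                                               M ℕ.+ suc (toℕ j)                ≡⟨ cong (M ℕ.+_) last ⟩
                                               M ℕ.+ M                          ≡⟨ M+M≡2*M ⟩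
                                               2 ℕ.* M                          ∎) ⟩
        0                                 ≡⟨ toℕ-next-last j last ⟨
        toℕ (next j)                      ≡⟨ toℕ-label₀ (next j) ⟨
        toℕ (label (zero , next j))       ∎

    coords-next : ∀ t → coords (next t) ≡ turn true (coords t)
    coords-next t = begin
      coords (next t)                          ≡⟨ cong (coords ∘ next) (label∘coords t) ⟨
      coords (next (label (coords t)))         ≡⟨ cong coords (next-label (coords t)) ⟩
      coords (label (turn true (coords t)))    ≡⟨ coords∘label (turn true (coords t)) ⟩
      turn true (coords t)                     ∎
      where open ≡-Reasoning

    succ-relabel : ∀ y c → succ y (label (relabel y c)) ≡ label (relabel y (turn (parity y) c))
    succ-relabel y c = begin
      label (step y (coords (label (relabel y c)))) ≡⟨ cong (label ∘ step y) (coords∘label (relabel y c)) ⟩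
      label (step y (relabel y c))                  ≡⟨ cong label (step-relabel y c) ⟩
      label (relabel y (turn (parity y) c))         ∎
      where open ≡-Reasoning

    input-oneCycle : ∀ y → parity y ≡ true → IsOneCycle (2 ℕ.* M) (input y)
    input-oneCycle y odd =
      σ , σ-injective , successorGraph-cycleEdges next (succ y) σ σ (succ≢ y) σ-involutive commute
      where
      σ : Fin (2 ℕ.* M) → Fin (2 ℕ.* M)
      σ = label ∘ relabel y ∘ coords
      σ-involutive : ∀ t → σ (σ t) ≡ t
      σ-involutive t = trans (cong (label ∘ relabel y) (coords∘label (relabel y (coords t))))
                             (trans (cong label (relabel-involutive y (coords t))) (label∘coords t))
      σ-injective : Injective _≡_ _≡_ σ
      σ-injective {a} {b} σa≡σb = trans (sym (σ-involutive a)) (trans (cong σ σa≡σb) (σ-involutive b))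
      commute : ∀ t → succ y (σ t) ≡ σ (next t)
      commute t = trans (succ-relabel y (coords t))
        (cong (label ∘ relabel y) (trans (cong (λ p → turn p (coords t)) odd) (sym (coords-next t))))

    input-twoCycles : ∀ y → parity y ≡ false → IsTwoCycles M (input y)
    input-twoCycles y even = σ , σ-injective , λ u v →
      Product.map (split ∘_) (_∘ join)
        (successorGraph-cycleEdges (λ (h , j) → h , next j) (succ y) σ σ⁻¹ (succ≢ y) σ∘σ⁻¹ commute u v)
      where
      σ : Coord → Fin (2 ℕ.* M)
      σ = label ∘ relabel y
      σ⁻¹ : Fin (2 ℕ.* M) → Coord
      σ⁻¹ = relabel y ∘ coords
      σ∘σ⁻¹ : ∀ t → σ (σ⁻¹ t) ≡ t
      σ∘σ⁻¹ t = trans (cong label (relabel-involutive y (coords t))) (label∘coords t)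
      σ-injective : Injective _≡_ _≡_ σ
      σ-injective {a} {b} σa≡σb = begin
        a                       ≡⟨ relabel-involutive y a ⟨
        relabel y (relabel y a) ≡⟨ cong (relabel y) (coords∘label (relabel y a)) ⟨
        σ⁻¹ (σ a)               ≡⟨ cong σ⁻¹ σa≡σb ⟩
        σ⁻¹ (σ b)               ≡⟨ cong (relabel y) (coords∘label (relabel y b)) ⟩
        relabel y (relabel y b) ≡⟨ relabel-involutive y b ⟩
        b                       ∎
        where open ≡-Reasoning
      commute : ∀ c → succ y (σ c) ≡ σ (proj₁ c , next (proj₂ c))
      commute (h , j) = trans (succ-relabel y (h , j))
        (cong (label ∘ relabel y) (trans (cong (λ p → turn p (h , j)) even) (turn-false h j)))
      split : ∀ {P : Coord → Set} → ∃[ c ] P c → ∃[ h ] ∃[ j ] P (h , j)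
      split ((h , j) , p) = h , j , p
      join : ∀ {P : Coord → Set} → ∃[ h ] ∃[ j ] P (h , j) → ∃[ c ] P c
      join (h , j , p) = (h , j) , p

open CubeDegree using (parity)
open RoundDegree using (roundDegree; module Rounds)
open CycleGadget using (module Gadget)
open import Data.Nat using (ℕ; zero; suc; _+_; _*_; _^_; _≤_; z≤n; s≤s)
import Data.Nat.Properties as ℕₚ
open import Data.Nat.Tactic.RingSolver using (solve-∀)
open import Data.Bool using (true; false)
open import Data.List using ([]; _∷_)
open import Data.Product using (_,_; proj₁; proj₂)
open import Relation.Binary.PropositionalEquality using (_≡_; sym; cong)

roundDegree≤ : ∀ S d₀ → 2 ≤ S → ∀ r → roundDegree S d₀ r ≤ d₀ * S ^ (3 * r)
roundDegree≤ S d₀ 2≤S zero    = ℕₚ.≤-reflexive (sym (ℕₚ.*-identityʳ d₀))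
roundDegree≤ S d₀ 2≤S (suc r) = begin
  S * (2 * (S * roundDegree S d₀ r))   ≤⟨ ℕₚ.*-monoʳ-≤ S (ℕₚ.*-monoˡ-≤ (S * roundDegree S d₀ r) 2≤S) ⟩
  S * (S * (S * roundDegree S d₀ r))   ≤⟨ ℕₚ.*-monoʳ-≤ S (ℕₚ.*-monoʳ-≤ S (ℕₚ.*-monoʳ-≤ S
                                             (roundDegree≤ S d₀ 2≤S r))) ⟩
  S * (S * (S * (d₀ * S ^ (3 * r))))   ≡⟨ reassociate S d₀ (S ^ (3 * r)) ⟩
  d₀ * S ^ (3 + 3 * r)                 ≡⟨ cong (λ e → d₀ * S ^ e) (ℕₚ.*-suc 3 r) ⟨
  d₀ * S ^ (3 * suc r)                 ∎
  where
  open ℕₚ.≤-Reasoning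
  reassociate : ∀ S d P → S * (S * (S * (d * P))) ≡ d * (S * (S * (S * P)))
  reassociate = solve-∀

1vs2Cycle-cycleLength≤ : ∀ S → 2 ≤ S → ∀ m A ans R →
                         Valid S A (2 * m) R → Computes1vs2Cycle S A m ans R → m ≤ 2 * S ^ (3 * R)
1vs2Cycle-cycleLength≤ S 2≤S zero          A ans R valid computes = z≤n
1vs2Cycle-cycleLength≤ S 2≤S (suc zero)    A ans R valid computes =
  ℕₚ.≤-trans (1≤S^ (3 * R)) (ℕₚ.m≤m+n (S ^ (3 * R)) _)
  where
  1≤S^ : ∀ e → 1 ≤ S ^ e
  1≤S^ zero    = s≤s z≤n
  1≤S^ (suc e) = ℕₚ.*-mono-≤ (ℕₚ.≤-trans (s≤s z≤n) 2≤S) (1≤S^ e)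
1vs2Cycle-cycleLength≤ S 2≤S (suc (suc m)) A ans R valid computes =
  ℕₚ.≤-trans (parity-lowerBound (ℕₚ.≤-trans (s≤s z≤n) 2≤S) input-junta valid ans answers)
             (roundDegree≤ S 2 2≤S R)
  where
  open Gadget m
  open Rounds S A {2 * M} {M} input
  answers : ∀ y → store S A (2 * M) (input y) R ≡ (ans , bit (parity y)) ∷ []
  answers y with parity y in eq
  ... | true  = proj₁ (computes (input y)) (input-oneCycle y eq)
  ... | false = proj₂ (computes (input y)) (input-twoCycles y eq)

theorem4p7 : (S : ℕ) → 2 ≤ S → (m : ℕ) → (A : Algorithm) → (ans R : ℕ) →
    Valid S A (2 * m) R → Computes1vs2Cycle S A m ans R →
    2 * m ≤ 32 * S ^ (3 * R)
theorem4p7 S 2≤S m A ans R valid computes = begin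
  2 * m                 ≤⟨ ℕₚ.*-monoʳ-≤ 2 (1vs2Cycle-cycleLength≤ S 2≤S m A ans R valid computes) ⟩
  2 * (2 * S ^ (3 * R)) ≡⟨ ℕₚ.*-assoc 2 2 (S ^ (3 * R)) ⟨
  4 * S ^ (3 * R)       ≤⟨ ℕₚ.*-monoˡ-≤ (S ^ (3 * R)) (ℕₚ.m≤m+n 4 28) ⟩
  32 * S ^ (3 * R)      ∎
  where open ℕₚ.≤-Reasoning
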